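{- For all integers $m\geq 3$ and $n\geq 2$, $$\chi_{lid}(C_m \square P_n)=\begin{cases}5 & \text{if } m=3,\\ 4 & \text{if } m \text{ is odd and } m\geq 5,\\ 3 & \text{if } m \text{ is even}.\end{cases}$$
   Context: $P_n$ denotes the path on $n$ vertices and $C_m$ the cycle on $m$ vertices. A proper $k$-coloring of a graph $G$ is a map $f:V(G)\to\{1,\dots,k\}$ with $f(u)\neq f(v)$ for every edge $uv$. For a vertex $v$, $N[v]$ denotes its closed neighborhood, and $f(S)=\{f(x):x\in S\}$. A lid-coloring of $G$ is a proper coloring $f$ such that for every edge $uv$ with $N[u]\neq N[v]$ we have $f(N[u])\neq f(N[v])$; $\chi_{lid}(G)$ is the smallest number of colors in a lid-coloring of $G$. The Cartesian product $G\square H$ has vertex set $V(G)\times V(H)$, where $(u_1,v_1)$ and $(u_2,v_2)$ are adjacent iff either $u_1=u_2$ and $v_1v_2\in E(H)$, or $v_1=v_2$ and $u_1u_2\in E(G)$. -}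

module Defs where

open import Data.Nat using (ℕ; suc; _+_; _≤_; _%_)
open import Data.Fin using (Fin; toℕ)
open import Data.Product using (Σ; ∃; _×_; _,_)
open import Data.Sum using (_⊎_)
open import Relation.Nullary using (¬_)
open import Relation.Binary.PropositionalEquality using (_≡_)
open import Function.Bundles using (_⇔_)

record Graph : Set₁ where
  field
    Vertex : Set
    Adj    : Vertex → Vertex → Set
open Graph public

Path : ℕ → Graph
Path n = record
  { Vertex = Fin n
  ; Adj    = λ i j → (toℕ j ≡ suc (toℕ i)) ⊎ (toℕ i ≡ suc (toℕ j)) }

Cycle : ℕ → Graph
Cycle m = record
  { Vertex = Fin m
  ; Adj    = λ i j → (toℕ j ≡ suc (toℕ i)) ⊎ (toℕ i ≡ suc (toℕ j))
                     ⊎ (toℕ i ≡ 0 × suc (toℕ j) ≡ m) ⊎ (toℕ j ≡ 0 × suc (toℕ i) ≡ m) }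

_□_ : Graph → Graph → Graph
G □ H = record
  { Vertex = Vertex G × Vertex H
  ; Adj    = λ { (u₁ , v₁) (u₂ , v₂) →
               (u₁ ≡ u₂ × Adj H v₁ v₂) ⊎ (v₁ ≡ v₂ × Adj G u₁ u₂) } }

InN : (G : Graph) → Vertex G → Vertex G → Set
InN G v x = (x ≡ v) ⊎ Adj G v x

ColIn : (G : Graph) {k : ℕ} → (Vertex G → Fin k) → Vertex G → Fin k → Set
ColIn G f v c = ∃ λ x → InN G v x × f x ≡ c

Proper : (G : Graph) {k : ℕ} → (Vertex G → Fin k) → Set
Proper G f = ∀ u v → Adj G u v → ¬ (f u ≡ f v)

IsLid : (G : Graph) {k : ℕ} → (Vertex G → Fin k) → Set
IsLid G f = Proper G f ×
  (∀ u v → Adj G u v →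
     ¬ (∀ x → InN G u x ⇔ InN G v x) →
     ¬ (∀ c → ColIn G f u c ⇔ ColIn G f v c))

HasLid : Graph → ℕ → Set
HasLid G k = Σ (Vertex G → Fin k) (IsLid G)

χlid≡ : Graph → ℕ → Set
χlid≡ G k = HasLid G k × (∀ j → HasLid G j → k ≤ j)

-- Upper bounds: give every column of the cycle a type, i.e. a pair of colours used on its even and on its
-- odd rows.  The colours seen by N[(a , i)] then depend only on the types of a - 1, a, a + 1 and on the
-- parity of i, so the lid conditions reduce to finitely many checks on windows of four consecutive types.
-- Lower bounds: adjacent vertices of row 0 are never twins.  With k colours, if their closed
-- neighbourhoods share k - 1 colours (the two endpoint colours when k = 3, the three colours of the
-- triangle when m = 3 and k = 4), their colour sets differ exactly when one of them contains every
-- colour; so "N[(a , 0)] contains every colour" is a proper 2-colouring of C_m, impossible for odd m.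
-- With two colours both neighbourhoods contain every colour, which is impossible outright.
module Submission where

open import Defs
open import Data.Nat using (ℕ; zero; suc; _+_; _≤_; _<_; _%_; z≤n; s≤s; parity; _≟_; _≤?_)
open import Data.Nat.Properties using (≰⇒>; ≤-pred; n<1+n; 1+n≰n; <-trans; <-irrefl; ≤∧≢⇒<; ≤-refl; <⇒≤; suc-injective; m≤n⇒m<n∨m≡n)
open import Data.Parity.Base using (Parity; 0ℙ; 1ℙ; _⁻¹) renaming (_+_ to _⊕_)
open import Data.Parity.Properties using (⁻¹-selfInverse; +-identityʳ; p≢p⁻¹; suc-homo-⁻¹)
open import Data.Fin using (Fin; toℕ; fromℕ<; inject≤; inject₁; #_) renaming (zero to fzero; suc to fsuc)
open import Data.Fin.Properties using (toℕ-fromℕ<; toℕ≤pred[n]; toℕ-inject₁; all?; inject≤-injective; injective⇒≤; any?) renaming (_≟_ to _≟ᶠ_)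
open import Data.Product using (Σ-syntax; ∃; _×_; _,_; proj₁; proj₂; uncurry)
open import Data.Product.Properties using (≡-dec)
open import Data.Sum using (_⊎_; inj₁; inj₂)
open import Data.List using (List; []; _∷_)
open import Data.List.Membership.Propositional using (_∈_)
open import Data.List.Relation.Unary.Any using (here; there)
import Data.List.Membership.DecPropositional as Membership
open import Data.Empty using (⊥-elim)
open import Level using (0ℓ)
open import Function using (_∘_)
open import Function.Bundles using (_⇔_; mk⇔; Equivalence)
open import Function.Properties.Equivalence using () renaming (sym to ⇔-sym; trans to ⇔-trans)
open import Function.Definitions using (Injective)
open import Relation.Nullary using (¬_; Dec; yes; no; contradiction; ¬?)
open import Relation.Nullary.Decidable using (map′; _×-dec_; _⊎-dec_; _→-dec_; from-yes)
open import Relation.Unary using (Pred; _⊆_; Universal; Decidable)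
open import Relation.Binary.Definitions using (DecidableEquality)
open import Relation.Binary.PropositionalEquality

parity-suc : ∀ n → parity (suc n) ≡ parity n ⁻¹
parity-suc n = sym (⁻¹-selfInverse (suc-homo-⁻¹ n))

%2≡1⇒parity≡1ℙ : ∀ n → n % 2 ≡ 1 → parity n ≡ 1ℙ
%2≡1⇒parity≡1ℙ (suc zero)    _ = refl
%2≡1⇒parity≡1ℙ (suc (suc n)) h = %2≡1⇒parity≡1ℙ n h

%2≡0⇒parity≡0ℙ : ∀ n → n % 2 ≡ 0 → parity n ≡ 0ℙ
%2≡0⇒parity≡0ℙ zero          _ = refl
%2≡0⇒parity≡0ℙ (suc (suc n)) h = %2≡0⇒parity≡0ℙ n h

≢⇒≡⁻¹ : ∀ {p q : Parity} → p ≢ q → q ≡ p ⁻¹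
≢⇒≡⁻¹ {0ℙ} {0ℙ} p≢q = contradiction refl p≢q
≢⇒≡⁻¹ {0ℙ} {1ℙ} _   = refl
≢⇒≡⁻¹ {1ℙ} {0ℙ} _   = refl
≢⇒≡⁻¹ {1ℙ} {1ℙ} p≢q = contradiction refl p≢q

⊕-⁻¹ : ∀ p q → (p ⊕ q) ⁻¹ ≡ p ⊕ q ⁻¹
⊕-⁻¹ 0ℙ q = refl
⊕-⁻¹ 1ℙ q = refl

Image : ∀ {A B : Set} → (A → B) → Pred B 0ℓ
Image ι b = ∃ λ a → ι a ≡ b

-- Pigeonhole: adjoining two further distinct colours to the image would inject Fin (2 + k) into Fin (1 + k).
image-misses-at-most-one : ∀ {k} (ι : Fin k → Fin (suc k)) → Injective _≡_ _≡_ ι →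
                           ∀ c e → c ≢ e → Image ι c ⊎ Image ι e
image-misses-at-most-one {k} ι ι-inj c e c≢e with any? (λ i → ι i ≟ᶠ c) | any? (λ i → ι i ≟ᶠ e)
... | yes c∈ι | _     = inj₁ c∈ι
... | no _    | yes e∈ι = inj₂ e∈ι
... | no c∉ι  | no e∉ι  = contradiction (injective⇒≤ extended-injective) 1+n≰n
  where
  extended : Fin (suc (suc k)) → Fin (suc k)
  extended fzero = c
  extended (fsuc fzero) = e
  extended (fsuc (fsuc i)) = ι i
  extended-injective : Injective _≡_ _≡_ extended
  extended-injective {fzero} {fzero} _ = refl
  extended-injective {fzero} {fsuc fzero} eq = contradiction eq c≢e
  extended-injective {fzero} {fsuc (fsuc j)} eq = contradiction (j , sym eq) c∉ι
  extended-injective {fsuc fzero} {fzero} eq = contradiction (sym eq) c≢e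
  extended-injective {fsuc fzero} {fsuc fzero} _ = refl
  extended-injective {fsuc fzero} {fsuc (fsuc j)} eq = contradiction (j , sym eq) e∉ι
  extended-injective {fsuc (fsuc i)} {fzero} eq = contradiction (i , eq) c∉ι
  extended-injective {fsuc (fsuc i)} {fsuc fzero} eq = contradiction (i , eq) e∉ι
  extended-injective {fsuc (fsuc i)} {fsuc (fsuc j)} eq = cong (fsuc ∘ fsuc) (ι-inj eq)

full-if-meets-outside : ∀ {k} {S : Pred (Fin (suc k)) 0ℓ} (ι : Fin k → Fin (suc k)) → Injective _≡_ _≡_ ι →
                        Image ι ⊆ S → ∀ {c} → S c → ¬ Image ι c → Π[ S ]
full-if-meets-outside ι ι-inj ι⊆S {c} Sc c∉ι e with e ≟ᶠ c
... | yes refl = Sc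
... | no e≢c with image-misses-at-most-one ι ι-inj e c e≢c
...   | inj₁ e∈ι = ι⊆S e∈ι
...   | inj₂ c∈ι = contradiction c∈ι c∉ι

⊆-if-full⇒full : ∀ {k} {S T : Pred (Fin (suc k)) 0ℓ} (ι : Fin k → Fin (suc k)) → Injective _≡_ _≡_ ι →
                 Image ι ⊆ S → Image ι ⊆ T → Decidable T → (Π[ S ] → Π[ T ]) → S ⊆ T
⊆-if-full⇒full ι ι-inj ι⊆S ι⊆T T? full⇒full {c} Sc with T? c
... | yes Tc = Tc
... | no ¬Tc = full⇒full (full-if-meets-outside ι ι-inj ι⊆S Sc (¬Tc ∘ ι⊆T)) c

same-if-full⇔full : ∀ {k} {S T : Pred (Fin (suc k)) 0ℓ} (ι : Fin k → Fin (suc k)) → Injective _≡_ _≡_ ι →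
                    Image ι ⊆ S → Image ι ⊆ T → Decidable S → Decidable T →
                    Π[ S ] ⇔ Π[ T ] → ∀ c → S c ⇔ T c
same-if-full⇔full ι ι-inj ι⊆S ι⊆T S? T? full⇔full c =
  mk⇔ (⊆-if-full⇒full ι ι-inj ι⊆S ι⊆T T? (Equivalence.to full⇔full))
      (⊆-if-full⇒full ι ι-inj ι⊆T ι⊆S S? (Equivalence.from full⇔full))

-- Along 0, 1, …, M the colour flips at every step, so c M ≡ c 0 ⊕ parity M,
-- and the edge between M and 0 then needs parity M ≡ 1ℙ.
odd-cycle-not-2-colourable : ∀ {M} → parity (suc M) ≡ 1ℙ → (c : Fin (suc M) → Parity) →
                             ¬ (∀ a a' → Adj (Cycle (suc M)) a a' → c a ≢ c a')
odd-cycle-not-2-colourable {M} odd c proper = p≢p⁻¹ (c fzero) (begin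
    c fzero                  ≡⟨ sym (+-identityʳ (c fzero)) ⟩
    c fzero ⊕ 0ℙ             ≡⟨ cong (c fzero ⊕_) (trans (sym (suc-homo-⁻¹ M)) (cong _⁻¹ odd)) ⟨
    c fzero ⊕ parity M       ≡⟨ colour-along M (n<1+n M) ⟨
    c (fromℕ< (n<1+n M))     ≡⟨ ≢⇒≡⁻¹ (proper fzero (fromℕ< (n<1+n M)) wrap) ⟩
    c fzero ⁻¹               ∎)
  where
  open ≡-Reasoning
  wrap : Adj (Cycle (suc M)) fzero (fromℕ< (n<1+n M))
  wrap = inj₂ (inj₂ (inj₁ (refl , cong suc (toℕ-fromℕ< (n<1+n M)))))
  colour-along : ∀ x (x<m : x < suc M) → c (fromℕ< x<m) ≡ c fzero ⊕ parity x
  colour-along zero _ = sym (+-identityʳ (c fzero))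
  colour-along (suc x) x+1<m = begin
    c (fromℕ< x+1<m)             ≡⟨ ≢⇒≡⁻¹ (proper _ _ step) ⟩
    c (fromℕ< x<m) ⁻¹            ≡⟨ cong _⁻¹ (colour-along x x<m) ⟩
    (c fzero ⊕ parity x) ⁻¹      ≡⟨ ⊕-⁻¹ (c fzero) (parity x) ⟩
    c fzero ⊕ parity x ⁻¹        ≡⟨ cong (c fzero ⊕_) (parity-suc x) ⟨
    c fzero ⊕ parity (suc x)     ∎
    where
    x<m : x < suc M
    x<m = <-trans (n<1+n x) x+1<m
    step : Adj (Cycle (suc M)) (fromℕ< x<m) (fromℕ< x+1<m)
    step = inj₁ (trans (toℕ-fromℕ< x+1<m) (cong suc (sym (toℕ-fromℕ< x<m))))

module _ (G : Graph) {j k} {ι : Fin j → Fin k} (ι-inj : Injective _≡_ _≡_ ι) (f : Vertex G → Fin j) where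

  colIn-injective : ∀ u c → ColIn G (ι ∘ f) u (ι c) ⇔ ColIn G f u c
  colIn-injective u c = mk⇔ (λ (x , x∈N , eq) → x , x∈N , ι-inj eq) (λ (x , x∈N , eq) → x , x∈N , cong ι eq)

  isLid-injective : IsLid G f → IsLid G (ι ∘ f)
  isLid-injective (proper , separates) =
    (λ u v uv → proper u v uv ∘ ι-inj) ,
    (λ u v uv not-twins same → separates u v uv not-twins λ c →
       ⇔-trans (⇔-sym (colIn-injective u c)) (⇔-trans (same (ι c)) (colIn-injective v c)))

hasLid-mono : ∀ G {j k} → j ≤ k → HasLid G j → HasLid G k
hasLid-mono G j≤k (f , lid) = _ , isLid-injective G {ι = λ c → inject≤ c j≤k} (inject≤-injective j≤k j≤k _ _) f lid

χlid≡-intro : ∀ G {k} → HasLid G (suc k) → ¬ HasLid G k → χlid≡ G (suc k)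
χlid≡-intro G lid no-lid = lid , least
  where
  least : ∀ j → HasLid G j → suc _ ≤ j
  least j lidⱼ with suc _ ≤? j
  ... | yes k<j = k<j
  ... | no k≮j  = contradiction (hasLid-mono G (≤-pred (≰⇒> k≮j)) lidⱼ) no-lid

module CyclicOrder (M : ℕ) where

  next : ℕ → ℕ
  next x with x ≟ M
  ... | yes _ = 0
  ... | no _  = suc x

  prev : ℕ → ℕ
  prev zero    = M
  prev (suc x) = x

  next-< : ∀ {x} → x < M → next x ≡ suc x
  next-< {x} x<M with x ≟ M
  ... | yes refl = contradiction x<M (<-irrefl refl)
  ... | no _     = refl

  next-last : next M ≡ 0
  next-last with M ≟ M
  ... | yes _   = refl
  ... | no M≢M  = contradiction refl M≢M

  next-≤ : ∀ {x} → x ≤ M → next x ≤ M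
  next-≤ {x} x≤M with x ≟ M
  ... | yes _   = z≤n
  ... | no x≢M  = ≤∧≢⇒< x≤M x≢M

  prev-≤ : ∀ {x} → x ≤ M → prev x ≤ M
  prev-≤ {zero}  _   = ≤-refl
  prev-≤ {suc x} x<M = <⇒≤ x<M

  prev-next : ∀ {x} → x ≤ M → prev (next x) ≡ x
  prev-next {x} x≤M with x ≟ M
  ... | yes x≡M = sym x≡M
  ... | no _    = refl

  next-prev : ∀ {x} → x ≤ M → next (prev x) ≡ x
  next-prev {zero}  _   = next-last
  next-prev {suc x} x<M = next-< x<M

  cycle-adj⇒next⊎prev : ∀ {a a'} → Adj (Cycle (suc M)) a a' → toℕ a' ≡ next (toℕ a) ⊎ toℕ a' ≡ prev (toℕ a)
  cycle-adj⇒next⊎prev {a} {a'} (inj₁ a'≡1+a) =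
    inj₁ (trans a'≡1+a (sym (next-< (subst (_≤ M) a'≡1+a (toℕ≤pred[n] a')))))
  cycle-adj⇒next⊎prev (inj₂ (inj₁ a≡1+a'))               = inj₂ (sym (cong prev a≡1+a'))
  cycle-adj⇒next⊎prev (inj₂ (inj₂ (inj₁ (a≡0 , 1+a'≡m)))) = inj₂ (trans (suc-injective 1+a'≡m) (sym (cong prev a≡0)))
  cycle-adj⇒next⊎prev (inj₂ (inj₂ (inj₂ (a'≡0 , 1+a≡m)))) = inj₁ (trans a'≡0 (sym (trans (cong next (suc-injective 1+a≡m)) next-last)))

  cycle-adj⇒next-either : ∀ {a a'} → Adj (Cycle (suc M)) a a' → toℕ a' ≡ next (toℕ a) ⊎ toℕ a ≡ next (toℕ a')
  cycle-adj⇒next-either {a} a~a' with cycle-adj⇒next⊎prev a~a'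
  ... | inj₁ a'≡next = inj₁ a'≡next
  ... | inj₂ a'≡prev = inj₂ (sym (trans (cong next a'≡prev) (next-prev (toℕ≤pred[n] a))))

  next⇒cycle-adj : ∀ {a a'} → toℕ a' ≡ next (toℕ a) → Adj (Cycle (suc M)) a a'
  next⇒cycle-adj {a} a'≡next with toℕ a ≟ M
  ... | yes a≡M = inj₂ (inj₂ (inj₂ (a'≡next , cong suc a≡M)))
  ... | no _    = inj₁ a'≡next

  prev⇒cycle-adj : ∀ {a a'} → toℕ a' ≡ prev (toℕ a) → Adj (Cycle (suc M)) a a'
  prev⇒cycle-adj {fzero}  a'≡M    = inj₂ (inj₂ (inj₁ (refl , cong suc a'≡M)))
  prev⇒cycle-adj {fsuc a} a'≡a    = inj₂ (inj₁ (cong suc (sym a'≡a)))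

module _ (L : ℕ) where
  open CyclicOrder (suc (suc L))

  cyclic-windows : (P : ℕ → ℕ → ℕ → ℕ → Set) →
                   P (suc (suc L)) 0 1 2 →
                   (∀ y → 3 + y ≤ suc (suc L) → P y (1 + y) (2 + y) (3 + y)) →
                   P L (suc L) (suc (suc L)) 0 →
                   P (suc L) (suc (suc L)) 0 1 →
                   ∀ x → x ≤ suc (suc L) → P (prev x) x (next x) (next (next x))
  cyclic-windows P first middle penultimate last zero _
    rewrite next-< {0} (s≤s z≤n) | next-< {1} (s≤s (s≤s z≤n)) = first
  cyclic-windows P first middle penultimate last (suc y) x≤M with m≤n⇒m<n∨m≡n x≤M
  ... | inj₂ refl rewrite next-last | next-< {0} (s≤s z≤n) = last
  ... | inj₁ x<M with m≤n⇒m<n∨m≡n x<M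
  ...   | inj₂ refl rewrite next-< x<M | next-last = penultimate
  ...   | inj₁ x+1<M rewrite next-< x<M | next-< x+1<M = middle y x+1<M

path-adj⇒parity-flips : ∀ {n} {i i' : Fin n} → Adj (Path n) i i' → parity (toℕ i') ≡ parity (toℕ i) ⁻¹
path-adj⇒parity-flips {i = i} (inj₁ i'≡1+i) = trans (cong parity i'≡1+i) (parity-suc (toℕ i))
path-adj⇒parity-flips {i' = i'} (inj₂ i≡1+i') =
  sym (⁻¹-selfInverse (sym (trans (cong parity i≡1+i') (parity-suc (toℕ i')))))

path-neighbour : ∀ {n} (i : Fin (suc (suc n))) → ∃ (Adj (Path (suc (suc n))) i)
path-neighbour fzero    = fsuc fzero , inj₁ refl
path-neighbour (fsuc i) = inject₁ i , inj₂ (cong suc (sym (toℕ-inject₁ i)))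

SameColours : ∀ {k} → List (Fin k) → List (Fin k) → Set
SameColours L₁ L₂ = ∀ c → c ∈ L₁ ⇔ c ∈ L₂

sameColours? : ∀ {k} (L₁ L₂ : List (Fin k)) → Dec (SameColours L₁ L₂)
sameColours? L₁ L₂ = all? λ c → map′ (uncurry mk⇔) (λ e → Equivalence.to e , Equivalence.from e)
                                     ((c ∈? L₁ →-dec c ∈? L₂) ×-dec (c ∈? L₂ →-dec c ∈? L₁))
  where open Membership _≟ᶠ_ using (_∈?_)

Column : ℕ → Set
Column k = Fin k × Fin k

column : ∀ {k} → Column k → Parity → Fin k
column (x , _) 0ℙ = x
column (_ , y) 1ℙ = y

module Windows (k : ℕ) where

  -- The colours of N[v] for v in column t₁ on a row of parity p, between columns t₀ and t₂.
  palette : Column k → Column k → Column k → Parity → List (Fin k)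
  palette t₀ t₁ t₂ p = column t₁ p ∷ column t₀ p ∷ column t₂ p ∷ column t₁ (p ⁻¹) ∷ []

  record GoodWindowAt (t₀ t₁ t₂ t₃ : Column k) (p : Parity) : Set where
    field
      vertical-proper      : column t₁ p ≢ column t₁ (p ⁻¹)
      horizontal-proper    : column t₁ p ≢ column t₂ p
      vertical-separated   : ¬ SameColours (palette t₀ t₁ t₂ p) (palette t₀ t₁ t₂ (p ⁻¹))
      horizontal-separated : ¬ SameColours (palette t₀ t₁ t₂ p) (palette t₁ t₂ t₃ p)

  GoodWindow : Column k → Column k → Column k → Column k → Set
  GoodWindow t₀ t₁ t₂ t₃ = ∀ p → GoodWindowAt t₀ t₁ t₂ t₃ p

  goodWindowAt? : ∀ t₀ t₁ t₂ t₃ p → Dec (GoodWindowAt t₀ t₁ t₂ t₃ p)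
  goodWindowAt? t₀ t₁ t₂ t₃ p =
    map′ (λ (a , b , c , d) → record { vertical-proper = a ; horizontal-proper = b
                                     ; vertical-separated = c ; horizontal-separated = d })
         (λ w → let open GoodWindowAt w in
                vertical-proper , horizontal-proper , vertical-separated , horizontal-separated)
         (¬? (column t₁ p ≟ᶠ column t₁ (p ⁻¹)) ×-dec ¬? (column t₁ p ≟ᶠ column t₂ p) ×-dec
          ¬? (sameColours? _ _) ×-dec ¬? (sameColours? _ _))

  goodWindow? : ∀ t₀ t₁ t₂ t₃ → Dec (GoodWindow t₀ t₁ t₂ t₃)
  goodWindow? t₀ t₁ t₂ t₃ = map′ (λ { (w₀ , w₁) 0ℙ → w₀ ; (w₀ , w₁) 1ℙ → w₁ }) (λ w → w 0ℙ , w 1ℙ)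
                                 (goodWindowAt? t₀ t₁ t₂ t₃ 0ℙ ×-dec goodWindowAt? t₀ t₁ t₂ t₃ 1ℙ)

module PatternColouring {M n k : ℕ} (T : ℕ → Column k) where
  open CyclicOrder M
  open Windows k public

  G : Graph
  G = Cycle (suc M) □ Path (suc (suc n))

  colouring : Vertex G → Fin k
  colouring (a , i) = column (T (toℕ a)) (parity (toℕ i))

  paletteAt : ℕ → Parity → List (Fin k)
  paletteAt x = palette (T (prev x)) (T x) (T (next x))

  colIn⇒palette : ∀ a i {c} → ColIn G colouring (a , i) c → c ∈ paletteAt (toℕ a) (parity (toℕ i))
  colIn⇒palette a i (_ , inj₁ refl , refl) = here refl
  colIn⇒palette a i ((_ , i') , inj₂ (inj₁ (refl , i~i')) , refl) =
    there (there (there (here (cong (column (T (toℕ a))) (path-adj⇒parity-flips i~i')))))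
  colIn⇒palette a i ((a' , _) , inj₂ (inj₂ (refl , a~a')) , refl) with cycle-adj⇒next⊎prev a~a'
  ... | inj₁ a'≡next = there (there (here (cong (λ x → column (T x) (parity (toℕ i))) a'≡next)))
  ... | inj₂ a'≡prev = there (here (cong (λ x → column (T x) (parity (toℕ i))) a'≡prev))

  palette⇒colIn : ∀ a i {c} → c ∈ paletteAt (toℕ a) (parity (toℕ i)) → ColIn G colouring (a , i) c
  palette⇒colIn a i (here refl) = (a , i) , inj₁ refl , refl
  palette⇒colIn a i (there (here refl)) =
    (a' , i) , inj₂ (inj₂ (refl , prev⇒cycle-adj a'≡prev)) , cong (λ x → column (T x) (parity (toℕ i))) a'≡prev
    where
    a' = fromℕ< (s≤s (prev-≤ (toℕ≤pred[n] a)))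
    a'≡prev = toℕ-fromℕ< (s≤s (prev-≤ (toℕ≤pred[n] a)))
  palette⇒colIn a i (there (there (here refl))) =
    (a' , i) , inj₂ (inj₂ (refl , next⇒cycle-adj a'≡next)) , cong (λ x → column (T x) (parity (toℕ i))) a'≡next
    where
    a' = fromℕ< (s≤s (next-≤ (toℕ≤pred[n] a)))
    a'≡next = toℕ-fromℕ< (s≤s (next-≤ (toℕ≤pred[n] a)))
  palette⇒colIn a i (there (there (there (here refl)))) =
    (a , i') , inj₂ (inj₁ (refl , i~i')) , cong (column (T (toℕ a))) (path-adj⇒parity-flips i~i')
    where
    i' = proj₁ (path-neighbour i)
    i~i' = proj₂ (path-neighbour i)

  colIn⇔palette : ∀ a i c → ColIn G colouring (a , i) c ⇔ c ∈ paletteAt (toℕ a) (parity (toℕ i))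
  colIn⇔palette a i c = mk⇔ (colIn⇒palette a i) (palette⇒colIn a i)

  separated-if-palettes-differ : ∀ a i a' i' →
    ¬ SameColours (paletteAt (toℕ a) (parity (toℕ i))) (paletteAt (toℕ a') (parity (toℕ i'))) →
    ¬ (∀ c → ColIn G colouring (a , i) c ⇔ ColIn G colouring (a' , i') c)
  separated-if-palettes-differ a i a' i' differ same =
    differ λ c → ⇔-trans (⇔-sym (colIn⇔palette a i c)) (⇔-trans (same c) (colIn⇔palette a' i' c))

  module _ (good : ∀ x → x ≤ M → GoodWindow (T (prev x)) (T x) (T (next x)) (T (next (next x)))) where
    open GoodWindowAt

    window : ∀ (a : Fin (suc M)) p → GoodWindowAt (T (prev (toℕ a))) (T (toℕ a)) (T (next (toℕ a))) (T (next (next (toℕ a)))) p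
    window a = good (toℕ a) (toℕ≤pred[n] a)

    horizontally-separated : ∀ (a : Fin (suc M)) p → ¬ SameColours (paletteAt (toℕ a) p) (paletteAt (next (toℕ a)) p)
    horizontally-separated a p =
      subst (λ y → ¬ SameColours (paletteAt (toℕ a) p) (palette (T y) (T (next (toℕ a))) (T (next (next (toℕ a)))) p))
            (sym (prev-next (toℕ≤pred[n] a)))
            (horizontal-separated (window a p))

    row-step : ∀ (a a' : Fin (suc M)) p → toℕ a' ≡ next (toℕ a) →
               column (T (toℕ a)) p ≢ column (T (toℕ a')) p × ¬ SameColours (paletteAt (toℕ a) p) (paletteAt (toℕ a') p)
    row-step a a' p a'≡next rewrite a'≡next = horizontal-proper (window a p) , horizontally-separated a p

    proper : Proper G colouring
    proper (a , i) (_ , i') (inj₁ (refl , i~i')) rewrite path-adj⇒parity-flips i~i' =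
      vertical-proper (window a (parity (toℕ i)))
    proper (a , i) (a' , _) (inj₂ (refl , a~a')) with cycle-adj⇒next-either a~a'
    ... | inj₁ a'≡next = proj₁ (row-step a a' (parity (toℕ i)) a'≡next)
    ... | inj₂ a≡next  = proj₁ (row-step a' a (parity (toℕ i)) a≡next) ∘ sym

    separates : ∀ u v → Adj G u v → ¬ (∀ x → InN G u x ⇔ InN G v x) →
                ¬ (∀ c → ColIn G colouring u c ⇔ ColIn G colouring v c)
    separates (a , i) (_ , i') (inj₁ (refl , i~i')) _ =
      separated-if-palettes-differ a i a i'
        (subst (λ p → ¬ SameColours (paletteAt (toℕ a) (parity (toℕ i))) (paletteAt (toℕ a) p))
               (sym (path-adj⇒parity-flips i~i')) (vertical-separated (window a (parity (toℕ i)))))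
    separates (a , i) (a' , _) (inj₂ (refl , a~a')) _ with cycle-adj⇒next-either a~a'
    ... | inj₁ a'≡next = separated-if-palettes-differ a i a' i (proj₂ (row-step a a' (parity (toℕ i)) a'≡next))
    ... | inj₂ a≡next  = separated-if-palettes-differ a i a' i
                           (λ same → proj₂ (row-step a' a (parity (toℕ i)) a≡next) (λ c → ⇔-sym (same c)))

    isLid : IsLid G colouring
    isLid = proper , separates

cycle-adj-sym : ∀ {m} {a a' : Fin m} → Adj (Cycle m) a a' → Adj (Cycle m) a' a
cycle-adj-sym (inj₁ e)                 = inj₂ (inj₁ e)
cycle-adj-sym (inj₂ (inj₁ e))          = inj₁ e
cycle-adj-sym (inj₂ (inj₂ (inj₁ e)))   = inj₂ (inj₂ (inj₂ e))
cycle-adj-sym (inj₂ (inj₂ (inj₂ e)))   = inj₂ (inj₂ (inj₁ e))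

cycle-adj? : ∀ {m} (a a' : Fin m) → Dec (Adj (Cycle m) a a')
cycle-adj? {m} a a' = (toℕ a' ≟ suc (toℕ a)) ⊎-dec (toℕ a ≟ suc (toℕ a')) ⊎-dec
                      ((toℕ a ≟ 0) ×-dec (suc (toℕ a') ≟ m)) ⊎-dec ((toℕ a' ≟ 0) ×-dec (suc (toℕ a) ≟ m))

path-adj? : ∀ {n} (i i' : Fin n) → Dec (Adj (Path n) i i')
path-adj? i i' = (toℕ i' ≟ suc (toℕ i)) ⊎-dec (toℕ i ≟ suc (toℕ i'))

□-adj? : ∀ {G H} → DecidableEquality (Vertex G) → DecidableEquality (Vertex H) →
         (∀ u u' → Dec (Adj G u u')) → (∀ v v' → Dec (Adj H v v')) →
         ∀ x y → Dec (Adj (G □ H) x y)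
□-adj? _≟G_ _≟H_ adjG? adjH? (u , v) (u' , v') = ((u ≟G u') ×-dec adjH? v v') ⊎-dec ((v ≟H v') ×-dec adjG? u u')

decToParity : ∀ {A : Set} → Dec A → Parity
decToParity (yes _) = 1ℙ
decToParity (no _)  = 0ℙ

decToParity-≡⇒⇔ : ∀ {A B : Set} (A? : Dec A) (B? : Dec B) → decToParity A? ≡ decToParity B? → A ⇔ B
decToParity-≡⇒⇔ (yes a) (yes b) _ = mk⇔ (λ _ → b) (λ _ → a)
decToParity-≡⇒⇔ (no ¬a) (no ¬b) _ = mk⇔ (⊥-elim ∘ ¬a) (⊥-elim ∘ ¬b)

module LidColouredPrism {m n j} (f : Fin m × Fin (suc (suc n)) → Fin (suc j))
                        (lid : IsLid (Cycle m □ Path (suc (suc n))) f) where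

  G : Graph
  G = Cycle m □ Path (suc (suc n))

  colIn? : ∀ u → Decidable (ColIn G f u)
  colIn? u c = map′ (λ (a , i , h) → (a , i) , h) (λ ((a , i) , h) → a , i , h)
                    (any? λ a → any? λ i → inN? (a , i) ×-dec (f (a , i) ≟ᶠ c))
    where
    inN? : ∀ x → Dec (InN G u x)
    inN? x = ≡-dec _≟ᶠ_ _≟ᶠ_ x u ⊎-dec □-adj? {Cycle m} {Path _} _≟ᶠ_ _≟ᶠ_ cycle-adj? path-adj? u x

  row-adj : ∀ {a a'} → Adj (Cycle m) a a' → Adj G (a , fzero) (a' , fzero)
  row-adj a~a' = inj₂ (refl , a~a')

  row-separated : ∀ {a a'} → Adj (Cycle m) a a' →
                  ¬ (∀ c → ColIn G f (a , fzero) c ⇔ ColIn G f (a' , fzero) c)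
  row-separated {a} {a'} a~a' = proj₂ lid _ _ (row-adj a~a') not-twins
    where
    -- The witness is (a , 1): it is adjacent to (a' , 0) only if a' ≡ a, which properness excludes.
    not-twins : ¬ (∀ x → InN G (a , fzero) x ⇔ InN G (a' , fzero) x)
    not-twins twins with Equivalence.to (twins (a , fsuc fzero)) (inj₂ (inj₁ (refl , inj₁ refl)))
    ... | inj₂ (inj₁ (a'≡a , _)) = proj₁ lid _ _ (row-adj a~a') (cong (λ b → f (b , fzero)) (sym a'≡a))

  own-colour : ∀ a → ColIn G f (a , fzero) (f (a , fzero))
  own-colour a = (a , fzero) , inj₁ refl , refl

  neighbour-colour : ∀ {a a'} → Adj (Cycle m) a a' → ColIn G f (a , fzero) (f (a' , fzero))
  neighbour-colour a~a' = _ , inj₂ (row-adj a~a') , refl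

  Full : Fin m → Set
  Full a = Π[ ColIn G f (a , fzero) ]

  SharesAllButOne : Fin m → Fin m → Set
  SharesAllButOne a a' = Σ[ ι ∈ (Fin j → Fin (suc j)) ]
    Injective _≡_ _≡_ ι × Image ι ⊆ ColIn G f (a , fzero) × Image ι ⊆ ColIn G f (a' , fzero)

  fullness-differs : ∀ {a a'} → Adj (Cycle m) a a' → SharesAllButOne a a' → ¬ (Full a ⇔ Full a')
  fullness-differs a~a' (ι , ι-inj , ι⊆N , ι⊆N') =
    row-separated a~a' ∘ same-if-full⇔full ι ι-inj ι⊆N ι⊆N' (colIn? _) (colIn? _)

  fullness : Fin m → Parity
  fullness a = decToParity (all? (colIn? (a , fzero)))

  fullness-flips : ∀ {a a'} → Adj (Cycle m) a a' → SharesAllButOne a a' → fullness a ≢ fullness a'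
  fullness-flips {a} {a'} a~a' shared =
    fullness-differs a~a' shared ∘ decToParity-≡⇒⇔ (all? (colIn? (a , fzero))) (all? (colIn? (a' , fzero)))

no-lid-2 : ∀ {m n} → ¬ HasLid (Cycle (suc (suc m)) □ Path (suc (suc n))) 2
no-lid-2 (f , lid) = fullness-differs 0~1 (ι , ι-inj , ι⊆N₀ , ι⊆N₁) (mk⇔ (λ _ → full₁) (λ _ → full₀))
  where
  open LidColouredPrism f lid
  0~1 : Adj (Cycle _) fzero (fsuc fzero)
  0~1 = inj₁ refl
  ι : Fin 1 → Fin 2
  ι _ = f (fzero , fzero)
  ι-inj : Injective _≡_ _≡_ ι
  ι-inj {fzero} {fzero} _ = refl
  ι⊆N₀ : Image ι ⊆ ColIn G f (fzero , fzero)
  ι⊆N₀ (_ , refl) = own-colour fzero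
  ι⊆N₁ : Image ι ⊆ ColIn G f (fsuc fzero , fzero)
  ι⊆N₁ (_ , refl) = neighbour-colour (cycle-adj-sym 0~1)
  -- f (1 , 0) is the colour outside the image of ι, and it occurs in both neighbourhoods.
  outside : ¬ Image ι (f (fsuc fzero , fzero))
  outside (_ , eq) = proj₁ lid _ _ (row-adj 0~1) eq
  full₀ : Full fzero
  full₀ = full-if-meets-outside ι ι-inj ι⊆N₀ (neighbour-colour 0~1) outside
  full₁ : Full (fsuc fzero)
  full₁ = full-if-meets-outside ι ι-inj ι⊆N₁ (own-colour (fsuc fzero)) outside

no-lid-3-odd : ∀ {M n} → parity (suc M) ≡ 1ℙ → ¬ HasLid (Cycle (suc M) □ Path (suc (suc n))) 3
no-lid-3-odd odd (f , lid) =
  odd-cycle-not-2-colourable odd fullness (λ a a' a~a' → fullness-flips a~a' (endpoints-shared a~a'))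
  where
  open LidColouredPrism f lid
  endpoints-shared : ∀ {a a'} → Adj (Cycle _) a a' → SharesAllButOne a a'
  endpoints-shared {a} {a'} a~a' = ι , ι-inj , ι⊆N , ι⊆N'
    where
    ι : Fin 2 → Fin 3
    ι fzero        = f (a , fzero)
    ι (fsuc fzero) = f (a' , fzero)
    ι-inj : Injective _≡_ _≡_ ι
    ι-inj {fzero}      {fzero}      _  = refl
    ι-inj {fzero}      {fsuc fzero} eq = contradiction eq (proj₁ lid _ _ (row-adj a~a'))
    ι-inj {fsuc fzero} {fzero}      eq = contradiction (sym eq) (proj₁ lid _ _ (row-adj a~a'))
    ι-inj {fsuc fzero} {fsuc fzero} _  = refl
    ι⊆N : Image ι ⊆ ColIn G f (a , fzero)
    ι⊆N (fzero      , refl) = own-colour a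
    ι⊆N (fsuc fzero , refl) = neighbour-colour a~a'
    ι⊆N' : Image ι ⊆ ColIn G f (a' , fzero)
    ι⊆N' (fzero      , refl) = neighbour-colour (cycle-adj-sym a~a')
    ι⊆N' (fsuc fzero , refl) = own-colour a'

triangle-complete : ∀ {s s' : Fin 3} → s ≢ s' → Adj (Cycle 3) s s'
triangle-complete {fzero}             {fzero}             s≢s' = contradiction refl s≢s'
triangle-complete {fzero}             {fsuc fzero}        _    = inj₁ refl
triangle-complete {fzero}             {fsuc (fsuc fzero)} _    = inj₂ (inj₂ (inj₁ (refl , refl)))
triangle-complete {fsuc fzero}        {fzero}             _    = inj₂ (inj₁ refl)
triangle-complete {fsuc fzero}        {fsuc fzero}        s≢s' = contradiction refl s≢s'
triangle-complete {fsuc fzero}        {fsuc (fsuc fzero)} _    = inj₁ refl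
triangle-complete {fsuc (fsuc fzero)} {fzero}             _    = inj₂ (inj₂ (inj₂ (refl , refl)))
triangle-complete {fsuc (fsuc fzero)} {fsuc fzero}        _    = inj₂ (inj₁ refl)
triangle-complete {fsuc (fsuc fzero)} {fsuc (fsuc fzero)} s≢s' = contradiction refl s≢s'

-- Row 0 is a triangle, so its three colours are distinct and lie in every N[(a , 0)].
no-lid-4-triangle : ∀ {n} → ¬ HasLid (Cycle 3 □ Path (suc (suc n))) 4
no-lid-4-triangle (f , lid) =
  odd-cycle-not-2-colourable refl fullness (λ a a' a~a' → fullness-flips a~a' (ι , ι-inj , ι⊆N , ι⊆N))
  where
  open LidColouredPrism f lid
  ι : Fin 3 → Fin 4
  ι s = f (s , fzero)
  ι-inj : Injective _≡_ _≡_ ι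
  ι-inj {s} {s'} eq with s ≟ᶠ s'
  ... | yes s≡s' = s≡s'
  ... | no s≢s'  = contradiction eq (proj₁ lid _ _ (row-adj (triangle-complete s≢s')))
  ι⊆N : ∀ {a} → Image ι ⊆ ColIn G f (a , fzero)
  ι⊆N {a} (s , refl) with a ≟ᶠ s
  ... | yes refl = own-colour a
  ... | no a≢s   = neighbour-colour (triangle-complete a≢s)

lid-5-triangle : ∀ {n} → HasLid (Cycle 3 □ Path (suc (suc n))) 5
lid-5-triangle = colouring , isLid (cyclic-windows 0 P
  (from-yes (goodWindow? (T 2) (T 0) (T 1) (T 2)))
  (λ { _ (s≤s (s≤s ())) })
  (from-yes (goodWindow? (T 0) (T 1) (T 2) (T 0)))
  (from-yes (goodWindow? (T 1) (T 2) (T 0) (T 1))))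
  where
  T : ℕ → Column 5
  T 0 = # 0 , # 1
  T 1 = # 1 , # 2
  T _ = # 3 , # 4
  open PatternColouring T
  P : ℕ → ℕ → ℕ → ℕ → Set
  P a b c d = GoodWindow (T a) (T b) (T c) (T d)

lid-3-even : ∀ {L n} → parity (suc L) ≡ 0ℙ → HasLid (Cycle (suc (suc (suc L))) □ Path (suc (suc n))) 3
lid-3-even {L} m-even = colouring , isLid (cyclic-windows L P first middle penultimate last)
  where
  -- The colour of (a , i) is (a mod 2) + (i mod 2).
  E : Parity → Column 3
  E 0ℙ = # 0 , # 1
  E 1ℙ = # 1 , # 2
  open PatternColouring (E ∘ parity)
  P : ℕ → ℕ → ℕ → ℕ → Set
  P a b c d = GoodWindow (E (parity a)) (E (parity b)) (E (parity c)) (E (parity d))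
  alternating : ∀ q → GoodWindow (E q) (E (q ⁻¹)) (E q) (E (q ⁻¹))
  alternating 0ℙ = from-yes (goodWindow? (E 0ℙ) (E 1ℙ) (E 0ℙ) (E 1ℙ))
  alternating 1ℙ = from-yes (goodWindow? (E 1ℙ) (E 0ℙ) (E 1ℙ) (E 0ℙ))
  L-odd : parity L ≡ 1ℙ
  L-odd = trans (sym (suc-homo-⁻¹ L)) (cong _⁻¹ m-even)
  first : P (suc (suc L)) 0 1 2
  first rewrite L-odd = alternating 1ℙ
  middle : ∀ y → 3 + y ≤ suc (suc L) → P y (1 + y) (2 + y) (3 + y)
  middle y _ rewrite parity-suc y = alternating (parity y)
  penultimate : P L (suc L) (suc (suc L)) 0
  penultimate = subst₂ (λ q r → GoodWindow (E q) (E r) (E q) (E 0ℙ)) (sym L-odd) (sym m-even) (alternating 1ℙ)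
  last : P (suc L) (suc (suc L)) 0 1
  last = subst₂ (λ q r → GoodWindow (E r) (E q) (E 0ℙ) (E 1ℙ)) (sym L-odd) (sym m-even) (alternating 0ℙ)

lid-4-odd : ∀ {K n} → parity (suc K) ≡ 1ℙ → HasLid (Cycle (5 + K) □ Path (suc (suc n))) 4
lid-4-odd {K} m-odd = colouring , isLid (cyclic-windows (suc (suc K)) P first middle penultimate last)
  where
  A B C D : Column 4
  A = # 0 , # 1
  B = # 2 , # 3
  C = # 1 , # 2
  D = # 3 , # 0
  AB : Parity → Column 4
  AB 0ℙ = A
  AB 1ℙ = B
  T : ℕ → Column 4
  T 0             = C
  T 1             = D
  T (suc (suc x)) = AB (parity x)
  open PatternColouring T
  P : ℕ → ℕ → ℕ → ℕ → Set
  P a b c d = GoodWindow (T a) (T b) (T c) (T d)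
  K-even : parity K ≡ 0ℙ
  K-even = trans (sym (suc-homo-⁻¹ K)) (cong _⁻¹ m-odd)
  first : P (4 + K) 0 1 2
  first rewrite K-even = from-yes (goodWindow? A C D A)
  middle : ∀ y → 3 + y ≤ 4 + K → P y (1 + y) (2 + y) (3 + y)
  middle 0             _ = from-yes (goodWindow? C D A B)
  middle 1             _ = from-yes (goodWindow? D A B A)
  middle (suc (suc z)) _ rewrite parity-suc z = alternating (parity z)
    where
    alternating : ∀ q → GoodWindow (AB q) (AB (q ⁻¹)) (AB q) (AB (q ⁻¹))
    alternating 0ℙ = from-yes (goodWindow? A B A B)
    alternating 1ℙ = from-yes (goodWindow? B A B A)
  penultimate : P (2 + K) (3 + K) (4 + K) 0
  penultimate = subst₂ (λ q r → GoodWindow (AB q) (AB r) (AB q) C) (sym K-even) (sym m-odd) (from-yes (goodWindow? A B A C))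
  last : P (3 + K) (4 + K) 0 1
  last = subst₂ (λ q r → GoodWindow (AB r) (AB q) C D) (sym K-even) (sym m-odd) (from-yes (goodWindow? B A C D))

χlid-triangle : ∀ {n} → χlid≡ (Cycle 3 □ Path (suc (suc n))) 5
χlid-triangle = χlid≡-intro _ lid-5-triangle no-lid-4-triangle

χlid-odd : ∀ {m n} → 5 ≤ m → parity m ≡ 1ℙ → χlid≡ (Cycle m □ Path (suc (suc n))) 4
χlid-odd (s≤s (s≤s (s≤s (s≤s (s≤s _))))) m-odd = χlid≡-intro _ (lid-4-odd m-odd) (no-lid-3-odd m-odd)

χlid-even : ∀ {m n} → 3 ≤ m → parity m ≡ 0ℙ → χlid≡ (Cycle m □ Path (suc (suc n))) 3
χlid-even (s≤s (s≤s (s≤s _))) m-even = χlid≡-intro _ (lid-3-even m-even) no-lid-2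

theorem5 : (m n : ℕ) → 3 ≤ m → 2 ≤ n →
    ((m ≡ 3 → χlid≡ (Cycle m □ Path n) 5)
    × (m % 2 ≡ 1 → 5 ≤ m → χlid≡ (Cycle m □ Path n) 4)
    × (m % 2 ≡ 0 → χlid≡ (Cycle m □ Path n) 3))
theorem5 m (suc (suc n)) 3≤m (s≤s (s≤s _)) =
  (λ { refl → χlid-triangle }) ,
  (λ m-odd 5≤m → χlid-odd 5≤m (%2≡1⇒parity≡1ℙ m m-odd)) ,
  (χlid-even 3≤m ∘ %2≡0⇒parity≡0ℙ m)
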